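{- Let $G$ and $H$ be simple graphs without isolated vertices. Then $(G\diamond H)/_R\cong G/_R\diamond H/_R$, and the map $\psi:(G\diamond H)/_R\to G/_R\diamond H/_R$ given by $\psi([(x,y)])=([x],[y])$ is an isomorphism. Moreover, $[(x,y)]=[x]\times[y]$ for every vertex $(x,y)$ of $G\diamond H$.
   Context: For a graph $G$, $N_G(x)$ denotes the neighbourhood of $x$. The relation $R=R_G$ on $V(G)$ is: $xRx'$ iff $N_G(x)=N_G(x')$; $[x]$ denotes the $R$-class of $x$. The quotient $G/_R$ has vertex set $\{[x]\mid x\in V(G)\}$ and edges $[x][y]$ for $xy\in E(G)$. Bipartite graphs come with a fixed bipartition $(L_G,R_G)$ (left and right parts). Diamond product: if $G,H$ are both bipartite, $G\diamond H$ has vertex set $(L_G\times L_H)\cup(R_G\times R_H)$; if exactly one of them is bipartite, or neither is, $G\diamond H$ has vertex set $V(G)\times V(H)$; in all cases $(a,b)(a',b')$ is an edge iff $aa'\in E(G)$ and $bb'\in E(H)$. (When one factor is bipartite the product is bipartite with parts given by the side of the bipartite coordinate; when neither is bipartite this is the ordinary direct product.) -}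

module Defs where

open import Data.Bool using (Bool; true; false)
open import Data.Bool.Properties using (not-¬)
open import Data.Product using (Σ; ∃; _×_; _,_; proj₁; proj₂)
open import Data.Unit using (⊤; tt)
open import Data.Empty using (⊥; ⊥-elim)
open import Relation.Nullary using (¬_)
open import Relation.Binary.PropositionalEquality
  using (_≡_; _≢_; refl; sym; trans; cong; subst)
open import Relation.Binary.Structures using (IsEquivalence)
open import Function.Bundles using (_⇔_)

-- Simple graphs (vertex equality = propositional equality)

record SimpleGraph : Set₁ where
  field
    V      : Set
    _~_    : V → V → Set
    ~-sym  : ∀ {x y} → x ~ y → y ~ x
    ~-irr  : ∀ {x} → ¬ (x ~ x)

-- Graphs whose vertex set is a setoid (needed for quotients, since
-- Agda has no quotient types: V/R is represented by V with equality R)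

record Graph : Set₁ where
  field
    V      : Set
    _≈_    : V → V → Set
    ≈-eq   : IsEquivalence _≈_
    _~_    : V → V → Set
    ~-resp : ∀ {x x' y y'} → x ≈ x' → y ≈ y' → x ~ y → x' ~ y'
    ~-sym  : ∀ {x y} → x ~ y → y ~ x
    ~-irr  : ∀ {x} → ¬ (x ~ x)

open Graph

⌊_⌋ : SimpleGraph → Graph
⌊ G ⌋ = record
  { V = SimpleGraph.V G ; _≈_ = _≡_
  ; ≈-eq = record { refl = refl ; sym = sym ; trans = trans }
  ; _~_ = SimpleGraph._~_ G
  ; ~-resp = λ { refl refl e → e }
  ; ~-sym = SimpleGraph.~-sym G ; ~-irr = SimpleGraph.~-irr G }

NoIsolated : Graph → Set
NoIsolated G = ∀ x → ∃ λ y → _~_ G x y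

-- The relation R: x R x' iff N(x) = N(x')  (equality of neighbourhoods)

SameNbh : (G : Graph) → V G → V G → Set
SameNbh G x x' = ∀ z → (_~_ G z x → _~_ G z x') × (_~_ G z x' → _~_ G z x)

-- the quotient G/R : vertices are R-classes (V with equality R),
-- [x][y] is an edge iff x'y' ∈ E(G) for some x' ∈ [x], y' ∈ [y]
module _ (G : Graph) where
  private
    R = SameNbh G
    _∼_ = _~_ G
    R-refl : ∀ {x} → R x x
    R-refl z = (λ e → e) , (λ e → e)
    R-sym : ∀ {x y} → R x y → R y x
    R-sym r z = proj₂ (r z) , proj₁ (r z)
    R-trans : ∀ {x y w} → R x y → R y w → R x w
    R-trans r s z = (λ e → proj₁ (s z) (proj₁ (r z) e)) , (λ e → proj₂ (r z) (proj₂ (s z) e))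

  quot : Graph
  quot = record
    { V = V G ; _≈_ = R
    ; ≈-eq = record { refl = R-refl ; sym = R-sym ; trans = R-trans }
    ; _~_ = λ x y → Σ (V G) λ x' → Σ (V G) λ y' → R x x' × R y y' × (x' ∼ y')
    ; ~-resp = λ { p q (x' , y' , r , s , e) → x' , y' , R-trans (R-sym p) r , R-trans (R-sym q) s , e }
    ; ~-sym = λ { (x' , y' , r , s , e) → y' , x' , s , r , ~-sym G e }
    ; ~-irr = λ { (x' , y' , r , s , e) →
        ~-irr G (proj₁ (R-trans (R-sym s) r x') e) }
    }

-- Bipartite graphs come with a fixed bipartition (side true = left)

record Bipartition (G : Graph) : Set where
  field
    side  : V G → Bool
    resp  : ∀ {x y} → _≈_ G x y → side x ≡ side y
    cross : ∀ {x y} → _~_ G x y → side x ≢ side y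

open Bipartition

data Kind (G : Graph) : Set where
  bip    : Bipartition G → Kind G
  nonbip : ¬ Bipartition G → Kind G

Ok : {G H : Graph} → Kind G → Kind H → V G × V H → Set
Ok (bip b) (bip c) (a , x) = side b a ≡ side c x
Ok _ _ _ = ⊤

diamond : (G H : Graph) → Kind G → Kind H → Graph
diamond G H kG kH = record
  { V = Σ (V G × V H) (Ok kG kH)
  ; _≈_ = λ { ((a , x) , _) ((b , y) , _) → _≈_ G a b × _≈_ H x y }
  ; ≈-eq = record
      { refl = IsEquivalence.refl (≈-eq G) , IsEquivalence.refl (≈-eq H)
      ; sym = λ { (p , q) → IsEquivalence.sym (≈-eq G) p , IsEquivalence.sym (≈-eq H) q }
      ; trans = λ { (p , q) (p' , q') → IsEquivalence.trans (≈-eq G) p p' , IsEquivalence.trans (≈-eq H) q q' } }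
  ; _~_ = λ { ((a , x) , _) ((b , y) , _) → _~_ G a b × _~_ H x y }
  ; ~-resp = λ { (p , q) (p' , q') (e , f) → ~-resp G p p' e , ~-resp H q q' f }
  ; ~-sym = λ { (e , f) → ~-sym G e , ~-sym H f }
  ; ~-irr = λ { (e , f) → ~-irr G e }
  }

private
  bool3 : ∀ {a b c : Bool} → a ≢ c → b ≢ c → a ≡ b
  bool3 {false} {false} _ _ = refl
  bool3 {true} {true} _ _ = refl
  bool3 {false} {true} {false} p _ = ⊥-elim (p refl)
  bool3 {false} {true} {true} _ q = ⊥-elim (q refl)
  bool3 {true} {false} {false} _ q = ⊥-elim (q refl)
  bool3 {true} {false} {true} p _ = ⊥-elim (p refl)

quotKind : (G : Graph) → NoIsolated G → Kind G → Kind (quot G)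
quotKind G ni (bip b) = bip record
  { side = side b ; resp = rs ; cross = λ { (x' , y' , r , s , e) eq →
      cross b e (trans (sym (rs r)) (trans eq (rs s))) } }
  where
  rs : ∀ {x x'} → SameNbh G x x' → side b x ≡ side b x'
  rs {x} {x'} r with ni x
  ... | y , e = bool3 (cross b e) (cross b (~-sym G (proj₁ (r y) (~-sym G e))))
quotKind G ni (nonbip n) = nonbip λ b' → n record
  { side = side b'
  ; resp = λ p → resp b' (λ z → (λ e → ~-resp G (IsEquivalence.refl (≈-eq G)) p e)
                               , (λ e → ~-resp G (IsEquivalence.refl (≈-eq G)) (IsEquivalence.sym (≈-eq G) p) e))
  ; cross = λ {x} {y} e → cross b' (x , y , (λ z → (λ f → f) , (λ f → f)) , (λ z → (λ f → f) , (λ f → f)) , e) }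

okMap : (G H : Graph) (niG : NoIsolated G) (niH : NoIsolated H)
        (kG : Kind G) (kH : Kind H) {p : V G × V H} →
        Ok kG kH p → Ok (quotKind G niG kG) (quotKind H niH kH) p
okMap G H niG niH (bip b) (bip c) o = o
okMap G H niG niH (bip b) (nonbip n) o = tt
okMap G H niG niH (nonbip m) kH o = tt

ψ : (G H : Graph) (kG : Kind G) (kH : Kind H) (niG : NoIsolated G) (niH : NoIsolated H) →
    V (quot (diamond G H kG kH)) →
    V (diamond (quot G) (quot H) (quotKind G niG kG) (quotKind H niH kH))
ψ G H kG kH niG niH ((x , y) , o) = (x , y) , okMap G H niG niH kG kH o

record IsIso (A B : Graph) (f : V A → V B) : Set where
  field
    f-resp  : ∀ {a a'} → _≈_ A a a' → _≈_ B (f a) (f a')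
    f-inj   : ∀ {a a'} → _≈_ B (f a) (f a') → _≈_ A a a'
    f-surj  : ∀ w → ∃ λ v → _≈_ B (f v) w
    f-adj   : ∀ {a a'} → _~_ A a a' → _~_ B (f a) (f a')
    f-adj⁻¹ : ∀ {a a'} → _~_ B (f a) (f a') → _~_ A a a'

{-# OPTIONS --safe #-}
-- Two vertices of G ⋄ H have the same neighbourhood iff their coordinates do.
-- One direction is immediate; for the other, a neighbour z of x in G is
-- completed to a neighbour (z , w) of (x , y) by any neighbour w of y, which
-- exists because H has no isolated vertices; (z , w) is a vertex of G ⋄ H
-- because both coordinates change side along an edge. Hence ψ is well defined and injective on classes, and edges transfer
-- by replacing endpoints with class representatives.
module Submission where

open import Defs
open import Data.Bool using (not)
open import Data.Bool.Properties using (¬-not)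
open import Data.Product using (Σ; ∃; _×_; _,_; proj₁; proj₂; map₂)
open import Data.Unit using (tt)
open import Function.Bundles using (_⇔_; mk⇔)
open import Relation.Binary.PropositionalEquality using (_≡_; sym; trans; cong)

open Graph
open Bipartition

SameNbh-refl : (G : Graph) {x : V G} → SameNbh G x x
SameNbh-refl G z = (λ e → e) , (λ e → e)

SameNbh-sym : (G : Graph) {x x' : V G} → SameNbh G x x' → SameNbh G x' x
SameNbh-sym G r z = proj₂ (r z) , proj₁ (r z)

neighbour : (G : Graph) → NoIsolated G → ∀ x → ∃ λ w → _~_ G w x
neighbour G ni x = map₂ (~-sym G) (ni x)

module _ {G : Graph} (b : Bipartition G) where

  side-adjacent : ∀ {x y} → _~_ G x y → side b x ≡ not (side b y)
  side-adjacent e = ¬-not (cross b e)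

  -- x and x' share the neighbour y, hence both lie opposite to y.
  SameNbh⇒side≡ : NoIsolated G → ∀ {x x'} → SameNbh G x x' → side b x ≡ side b x'
  SameNbh⇒side≡ ni {x} r with ni x
  ... | y , e = trans (side-adjacent e)
                      (sym (side-adjacent (~-sym G (proj₁ (r y) (~-sym G e)))))

module _ {G H : Graph} (niG : NoIsolated G) (niH : NoIsolated H) where

  Ok-resp : (kG : Kind G) (kH : Kind H) → ∀ {x y x' y'} →
            SameNbh G x x' → SameNbh H y y' → Ok kG kH (x , y) → Ok kG kH (x' , y')
  Ok-resp (bip bg) (bip bh) r s o =
    trans (sym (SameNbh⇒side≡ bg niG r)) (trans o (SameNbh⇒side≡ bh niH s))
  Ok-resp (bip _)    (nonbip _) _ _ _ = tt
  Ok-resp (nonbip _) _          _ _ _ = tt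

  Ok-unquot : (kG : Kind G) (kH : Kind H) → ∀ {p} →
              Ok (quotKind G niG kG) (quotKind H niH kH) p → Ok kG kH p
  Ok-unquot (bip _)    (bip _)    o = o
  Ok-unquot (bip _)    (nonbip _) _ = tt
  Ok-unquot (nonbip _) _          _ = tt

  adjacentˡ-lift : (kG : Kind G) (kH : Kind H) → ∀ {x y z} → Ok kG kH (x , y) →
                   _~_ G z x → ∃ λ w → _~_ H w y × Ok kG kH (z , w)
  adjacentˡ-lift (bip bg) (bip bh) {y = y} o e with neighbour H niH y
  ... | w , f = w , f , trans (side-adjacent bg e)
                              (trans (cong not o) (sym (side-adjacent bh f)))
  adjacentˡ-lift (bip _)    (nonbip _) {y = y} _ _ = map₂ (_, tt) (neighbour H niH y)
  adjacentˡ-lift (nonbip _) _          {y = y} _ _ = map₂ (_, tt) (neighbour H niH y)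

  adjacentʳ-lift : (kG : Kind G) (kH : Kind H) → ∀ {x y w} → Ok kG kH (x , y) →
                   _~_ H w y → ∃ λ z → _~_ G z x × Ok kG kH (z , w)
  adjacentʳ-lift (bip bg) (bip bh) {x = x} o f with neighbour G niG x
  ... | z , e = z , e , trans (side-adjacent bg e)
                              (trans (cong not o) (sym (side-adjacent bh f)))
  adjacentʳ-lift (bip _)    (nonbip _) {x = x} _ _ = map₂ (_, tt) (neighbour G niG x)
  adjacentʳ-lift (nonbip _) _          {x = x} _ _ = map₂ (_, tt) (neighbour G niG x)

module _ (G H : Graph) (kG : Kind G) (kH : Kind H) where

  SameNbh-diamond : ∀ {x y x' y'} (o : Ok kG kH (x , y)) (o' : Ok kG kH (x' , y')) →
                    SameNbh G x x' → SameNbh H y y' →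
                    SameNbh (diamond G H kG kH) ((x , y) , o) ((x' , y') , o')
  SameNbh-diamond _ _ r s ((z , w) , _) =
      (λ { (e , f) → proj₁ (r z) e , proj₁ (s w) f })
    , (λ { (e , f) → proj₂ (r z) e , proj₂ (s w) f })

  module _ (niG : NoIsolated G) (niH : NoIsolated H) where

    SameNbh-diamond⇒ˡ : ∀ {x y x' y'} (o : Ok kG kH (x , y)) (o' : Ok kG kH (x' , y')) →
                        SameNbh (diamond G H kG kH) ((x , y) , o) ((x' , y') , o') →
                        SameNbh G x x'
    SameNbh-diamond⇒ˡ o o' r z =
        (λ e → let (w , f , ok) = adjacentˡ-lift niG niH kG kH o e
               in proj₁ (proj₁ (r ((z , w) , ok)) (e , f)))
      , (λ e → let (w , f , ok) = adjacentˡ-lift niG niH kG kH o' e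
               in proj₁ (proj₂ (r ((z , w) , ok)) (e , f)))

    SameNbh-diamond⇒ʳ : ∀ {x y x' y'} (o : Ok kG kH (x , y)) (o' : Ok kG kH (x' , y')) →
                        SameNbh (diamond G H kG kH) ((x , y) , o) ((x' , y') , o') →
                        SameNbh H y y'
    SameNbh-diamond⇒ʳ o o' r w =
        (λ f → let (z , e , ok) = adjacentʳ-lift niG niH kG kH o f
               in proj₂ (proj₁ (r ((z , w) , ok)) (e , f)))
      , (λ f → let (z , e , ok) = adjacentʳ-lift niG niH kG kH o' f
               in proj₂ (proj₂ (r ((z , w) , ok)) (e , f)))

    diamond-class : ∀ x y (o : Ok kG kH (x , y)) x' y' →
                    Σ (Ok kG kH (x' , y')) (λ o' →
                      SameNbh (diamond G H kG kH) ((x' , y') , o') ((x , y) , o))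
                    ⇔ (SameNbh G x' x × SameNbh H y' y)
    diamond-class x y o x' y' = mk⇔
      (λ (o' , r) → SameNbh-diamond⇒ˡ o' o r , SameNbh-diamond⇒ʳ o' o r)
      (λ (r , s) → let o' = Ok-resp niG niH kG kH (SameNbh-sym G r) (SameNbh-sym H s) o
                   in o' , SameNbh-diamond o' o r s)

    ψ-isIso : IsIso (quot (diamond G H kG kH))
                    (diamond (quot G) (quot H) (quotKind G niG kG) (quotKind H niH kH))
                    (ψ G H kG kH niG niH)
    ψ-isIso = record
      { f-resp  = λ { {_ , o} {_ , o'} r →
                      SameNbh-diamond⇒ˡ o o' r , SameNbh-diamond⇒ʳ o o' r }
      ; f-inj   = λ { {_ , o} {_ , o'} (r , s) → SameNbh-diamond o o' r s }
      ; f-surj  = λ (p , o) → (p , Ok-unquot niG niH kG kH o) , SameNbh-refl G , SameNbh-refl H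
      ; f-adj   = λ { {_ , o} {_ , o'} (((x₁ , y₁) , o₁) , ((x₂ , y₂) , o₂) , r₁ , r₂ , e , f) →
                        (x₁ , x₂ , SameNbh-diamond⇒ˡ o o₁ r₁ , SameNbh-diamond⇒ˡ o' o₂ r₂ , e)
                      , (y₁ , y₂ , SameNbh-diamond⇒ʳ o o₁ r₁ , SameNbh-diamond⇒ʳ o' o₂ r₂ , f) }
      ; f-adj⁻¹ = λ { {_ , o} {_ , o'} ((x₁ , x₂ , r₁ , r₂ , e) , (y₁ , y₂ , s₁ , s₂ , f)) →
                        let o₁ = Ok-resp niG niH kG kH r₁ s₁ o
                            o₂ = Ok-resp niG niH kG kH r₂ s₂ o'
                        in ((x₁ , y₁) , o₁) , ((x₂ , y₂) , o₂)
                         , SameNbh-diamond o o₁ r₁ s₁ , SameNbh-diamond o' o₂ r₂ s₂ , e , f }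
      }

lemma5p8 : (G H : SimpleGraph) (kG : Kind ⌊ G ⌋) (kH : Kind ⌊ H ⌋)
           (niG : NoIsolated ⌊ G ⌋) (niH : NoIsolated ⌊ H ⌋) →
           IsIso (quot (diamond ⌊ G ⌋ ⌊ H ⌋ kG kH))
                 (diamond (quot ⌊ G ⌋) (quot ⌊ H ⌋) (quotKind ⌊ G ⌋ niG kG) (quotKind ⌊ H ⌋ niH kH))
                 (ψ ⌊ G ⌋ ⌊ H ⌋ kG kH niG niH)
           × (∀ x y (o : Ok kG kH (x , y)) x' y' →
                (Σ (Ok kG kH (x' , y')) (λ o' →
                   SameNbh (diamond ⌊ G ⌋ ⌊ H ⌋ kG kH) ((x' , y') , o') ((x , y) , o)))
                ⇔ (SameNbh ⌊ G ⌋ x' x × SameNbh ⌊ H ⌋ y' y))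
lemma5p8 G H kG kH niG niH =
  ψ-isIso ⌊ G ⌋ ⌊ H ⌋ kG kH niG niH , diamond-class ⌊ G ⌋ ⌊ H ⌋ kG kH niG niH
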